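{- Let $\mathcal{M}$ be a regular $n$-maniplex, and let $\mathcal{S}_0$ be a set of facets of $\mathcal{M}$ that is not invariant under any non-trivial element of $\mathrm{Aut}(\mathcal{M})$. Then there exists an involutory element $\eta$ of the monodromy group $\mathrm{Mon}(\hat{2}^{\mathcal{M}})$ such that $\eta$ maps every two distinct flags of $\hat{2}^{\mathcal{M}}$ lying in the same facet of $\hat{2}^{\mathcal{M}}$ to flags lying in distinct facets of $\hat{2}^{\mathcal{M}}$.
   Context: An $n$-maniplex is a pair $(\mathcal{F},\{r_0,\ldots,r_{n-1}\})$ where $\mathcal{F}$ is a non-empty set of flags and $r_0,\ldots,r_{n-1}$ are fixed-point-free involutory permutations of $\mathcal{F}$ such that $\langle r_0,\ldots,r_{n-1}\rangle$ (the monodromy group) is transitive on $\mathcal{F}$, $\Phi^{r_i}\neq\Phi^{r_j}$ for all $\Phi$ and $i\ne j$, and $r_ir_j=r_jr_i$ whenever $|i-j|\ge2$. An automorphism is a permutation of $\mathcal{F}$ commuting with every $r_i$; the maniplex is regular if $\mathrm{Aut}(\mathcal{M})$ is transitive on flags. The facets are the orbits of $\langle r_0,\ldots,r_{n-2}\rangle$; automorphisms permute facets. For an $n$-maniplex $\mathcal{M}$ with set of facets $\mathcal{S}$, let $F(\Phi)$ be the facet containing $\Phi$ and $\chi_F\in\mathbb{Z}_2^{\mathcal{S}}$ the characteristic function of $F$; the $(n+1)$-maniplex $\hat{2}^{\mathcal{M}}$ has flag set $\mathcal{F}(\mathcal{M})\times\mathbb{Z}_2^{\mathcal{S}}$ and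 permutations $(\Phi,x)^{r'_i}=(\Phi^{r_i},x)$ for $i<n$ and $(\Phi,x)^{r'_n}=(\Phi,x+\chi_{F(\Phi)})$; its monodromy group is $\langle r'_0,\ldots,r'_n\rangle$ and its facets are the orbits of $\langle r'_0,\ldots,r'_{n-1}\rangle$. -}

module Defs where

open import Data.Nat using (ℕ; zero; suc; _<_; _<?_)
open import Relation.Nullary using (yes; no)
open import Data.Fin using (Fin; toℕ; fromℕ<)
open import Data.Bool using (Bool; not)
open import Data.Vec using (Vec; updateAt; lookup)
open import Data.List using (List; []; _∷_)
open import Data.List.Relation.Unary.All using (All)
open import Data.Product using (Σ; ∃; _×_; _,_)
open import Relation.Binary.PropositionalEquality using (_≡_; _≢_)
open import Function.Bundles using (_⇔_)

-- Permutation systems: a set X with generators r : Fin k → X → X.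
-- Words act on the right: Φ^(r_{i1} r_{i2} ...) = act (i1 ∷ i2 ∷ ...) Φ.

act : {X : Set} {k : ℕ} → (Fin k → X → X) → List (Fin k) → X → X
act r []      Φ = Φ
act r (i ∷ w) Φ = act r w (r i Φ)

-- Φ and Ψ lie in the same orbit of the subgroup generated by the r_i with
-- i satisfying P (generators are involutions, so words suffice).
SameOrbit : {X : Set} {k : ℕ} → (Fin k → X → X) → (Fin k → Set) → X → X → Set
SameOrbit {k = k} r P Φ Ψ = Σ (List (Fin k)) λ w → All P w × act r w Φ ≡ Ψ

InMon : {X : Set} {k : ℕ} → (Fin k → X → X) → (X → X) → Set
InMon {k = k} r η = Σ (List (Fin k)) λ w → ∀ Φ → act r w Φ ≡ η Φ

record Maniplex (n m : ℕ) : Set where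
  field
    r          : Fin n → Fin m → Fin m
    nonempty   : 0 < m
    involution : ∀ i Φ → r i (r i Φ) ≡ Φ
    fpf        : ∀ i Φ → r i Φ ≢ Φ
    distinct   : ∀ i j Φ → i ≢ j → r i Φ ≢ r j Φ
    commute    : ∀ i j Φ → suc (toℕ i) < toℕ j → r i (r j Φ) ≡ r j (r i Φ)
    transitive : ∀ Φ Ψ → ∃ λ w → act r w Φ ≡ Ψ

  FacetGen : Fin n → Set
  FacetGen i = suc (toℕ i) < n

  SameFacet : Fin m → Fin m → Set
  SameFacet = SameOrbit r FacetGen

  IsAut : (Fin m → Fin m) → Set
  IsAut α = (Σ (Fin m → Fin m) λ β → (∀ Φ → β (α Φ) ≡ Φ) × (∀ Φ → α (β Φ) ≡ Φ))
          × (∀ i Φ → α (r i Φ) ≡ r i (α Φ))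

  IsRegular : Set
  IsRegular = ∀ Φ Ψ → Σ (Fin m → Fin m) λ α → IsAut α × α Φ ≡ Ψ

-- A labelling of the facets of M by Fin s: a surjection from flags onto
-- Fin s whose fibres are exactly the facets.  (Fin s plays the role of
-- the set of facets 𝒮.)
record FacetLabelling {n m : ℕ} (M : Maniplex n m) (s : ℕ) : Set where
  open Maniplex M
  field
    facet    : Fin m → Fin s
    surj     : ∀ F → ∃ λ Φ → facet Φ ≡ F
    exact    : ∀ Φ Ψ → (facet Φ ≡ facet Ψ) ⇔ SameFacet Φ Ψ

-- The maniplex 2̂^M: flags Fin m × ℤ₂^𝒮 (with ℤ₂^𝒮 = Vec Bool s).

Flag2 : ℕ → ℕ → Set
Flag2 m s = Fin m × Vec Bool s

-- Index i with toℕ i < n is r'_i (acting as r_i on the first coordinate);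
-- index n is r'_n, adding χ_{F(Φ)} (flipping the coordinate facet Φ).
r′ : {n m s : ℕ} → Maniplex n m → (Fin m → Fin s) → Fin (suc n) → Flag2 m s → Flag2 m s
r′ {n} M facet i (Φ , x) with toℕ i <? n
... | yes p = (Maniplex.r M (fromℕ< p) Φ , x)
... | no _  = (Φ , updateAt x (facet Φ) not)

SameFacet2 : {n m s : ℕ} → Maniplex n m → (Fin m → Fin s) → Flag2 m s → Flag2 m s → Set
SameFacet2 {n} M facet = SameOrbit (r′ M facet) (λ i → toℕ i < n)

{-# OPTIONS --safe #-}
module Submission where

-- Fix a base flag Φ₀ and, for every flag Φ, the automorphism β_Φ (transport Φ) with β_Φ Φ₀ = Φ.
-- If a word u leads from Φ₀ into the facet F, then Φ^u = β_Φ (Φ₀^u), so u r′ₙ u⁻¹ fixes the first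
-- coordinate of (Φ , x) and adds χ_{β_Φ F} to x.  The product η of these over F ∈ S₀ thus acts as
-- (Φ , x) ↦ (Φ , x + χ_{β_Φ S₀}), an involution.  Facets of 2̂^M have constant second coordinate,
-- so if η sends two flags (Φ , x) ≠ (Φ′ , x) of one facet into a common facet, then β_Φ S₀ = β_Φ′ S₀;
-- hence β_Φ′⁻¹ β_Φ fixes S₀, is trivial, and Φ = Φ′.  Finally η ≠ id needs S₀ ≠ ∅, which holds after
-- replacing S₀ by its complement if necessary.

open import Defs
open import Algebra.Bundles using (CommutativeRing)
open import Data.Bool using (Bool; true; false; not; _∧_; _xor_; if_then_else_)
open import Data.Bool.Properties
  using (xor-∧-commutativeRing; xor-assoc; xor-comm; true-xor; xor-same; xor-identityʳ; ∧-identityʳ; ∧-zeroʳ; not-injective)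
open import Data.Empty using (⊥-elim)
open import Data.Fin using (Fin; zero; suc; toℕ; fromℕ; fromℕ<; inject₁; punchIn; _≟_)
open import Data.Fin.Properties using (toℕ-injective; toℕ-fromℕ<; toℕ-inject₁; toℕ-fromℕ; toℕ<n; punchInᵢ≢i)
open import Data.List using (List; []; _∷_; _++_; _∷ʳ_; map; reverse; concat)
import Data.List as List
open import Data.List.Properties using (unfold-reverse)
open import Data.List.Relation.Unary.All using ([]; _∷_)
open import Data.Nat using (ℕ; suc; _<_; _<?_)
open import Data.Nat.Properties using (<-irrefl)
open import Data.Product using (Σ; ∃; _×_; _,_; proj₁; proj₂)
open import Data.Vec using (Vec; lookup; updateAt; tabulate; replicate)
open import Data.Vec.Properties using (lookup∘tabulate; tabulate∘lookup; tabulate-cong; lookup∘updateAt; lookup∘updateAt′)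
open import Function using (_∘_)
open import Function.Bundles using (Equivalence)
open import Relation.Binary.PropositionalEquality
  using (_≡_; _≢_; refl; sym; trans; cong; subst; module ≡-Reasoning)
open import Relation.Nullary using (¬_; yes; no; does)

open CommutativeRing xor-∧-commutativeRing using (+-commutativeMonoid; +-group)
open import Algebra.Properties.CommutativeMonoid.Sum +-commutativeMonoid
  using (sum; sum-remove; sum-cong-≗; sum-replicate-zero)
open import Algebra.Properties.Group +-group using (∙-cancelˡ)

module _ {X : Set} {k : ℕ} (r : Fin k → X → X) where

  act-++ : ∀ u v Φ → act r (u ++ v) Φ ≡ act r v (act r u Φ)
  act-++ []      v Φ = refl
  act-++ (i ∷ u) v Φ = act-++ u v (r i Φ)

  act-reverse : (∀ i Φ → r i (r i Φ) ≡ Φ) → ∀ w Φ → act r (reverse w) (act r w Φ) ≡ Φ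
  act-reverse involutive []      Φ = refl
  act-reverse involutive (i ∷ w) Φ = begin
    act r (reverse (i ∷ w)) (act r w (r i Φ))       ≡⟨ cong (λ v → act r v (act r w (r i Φ))) (unfold-reverse i w) ⟩
    act r (reverse w ∷ʳ i) (act r w (r i Φ))        ≡⟨ act-++ (reverse w) (i ∷ []) _ ⟩
    r i (act r (reverse w) (act r w (r i Φ)))       ≡⟨ cong (r i) (act-reverse involutive w (r i Φ)) ⟩
    r i (r i Φ)                                     ≡⟨ involutive i Φ ⟩
    Φ                                               ∎
    where open ≡-Reasoning

  sameOrbit-invariant : ∀ {B : Set} {P : Fin k → Set} (p : X → B) →
    (∀ i → P i → ∀ Φ → p (r i Φ) ≡ p Φ) → ∀ {Φ Ψ} → SameOrbit r P Φ Ψ → p Φ ≡ p Ψ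
  sameOrbit-invariant p invariant ([]    , []       , refl) = refl
  sameOrbit-invariant p invariant (i ∷ w , Pi ∷ Pw , eq)    =
    trans (sym (invariant i Pi _)) (sameOrbit-invariant p invariant (w , Pw , eq))

module _ {X Y : Set} {k : ℕ} (r : Fin k → X → X) (R : Fin k → Y → Y) (h : X → Y)
         (equivariant : ∀ i Φ → h (r i Φ) ≡ R i (h Φ)) where

  act-equivariant : ∀ w Φ → h (act r w Φ) ≡ act R w (h Φ)
  act-equivariant []      Φ = refl
  act-equivariant (i ∷ w) Φ = trans (act-equivariant w (r i Φ)) (cong (act R w) (equivariant i Φ))

  sameOrbit-equivariant : ∀ {P : Fin k → Set} {Φ Ψ} → SameOrbit r P Φ Ψ → SameOrbit R P (h Φ) (h Ψ)
  sameOrbit-equivariant (w , Pw , eq) = w , Pw , trans (sym (act-equivariant w _)) (cong h eq)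

act-map : ∀ {X : Set} {k l} (R : Fin l → X → X) (f : Fin k → Fin l) w Φ →
          act R (map f w) Φ ≡ act (R ∘ f) w Φ
act-map R f []      Φ = refl
act-map R f (i ∷ w) Φ = act-map R f w (R (f i) Φ)

sum-δ : ∀ {t} (v : Fin t → Bool) i → (∀ j → j ≢ i → v j ≡ false) → sum v ≡ v i
sum-δ {suc t} v i vanishes = begin
  sum v                                ≡⟨ sum-remove {i = i} v ⟩
  v i xor sum (v ∘ punchIn i)          ≡⟨ cong (v i xor_) (sum-cong-≗ (λ j → vanishes _ (punchInᵢ≢i i j))) ⟩
  v i xor sum {t} (λ _ → false)        ≡⟨ cong (v i xor_) (sum-replicate-zero t) ⟩
  v i xor false                        ≡⟨ xor-identityʳ (v i) ⟩
  v i                                  ∎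
  where open ≡-Reasoning

sum-∧-fibre : ∀ {t t'} (p : Fin t → Bool) (π : Fin t → Fin t') (σ : Fin t' → Fin t) →
  (∀ j → σ (π j) ≡ j) → (∀ k → π (σ k) ≡ k) →
  ∀ k → sum (λ j → p j ∧ does (π j ≟ k)) ≡ p (σ k)
sum-∧-fibre p π σ σπ πσ k = trans (sum-δ _ (σ k) off-fibre) at-σk
  where
  off-fibre : ∀ j → j ≢ σ k → p j ∧ does (π j ≟ k) ≡ false
  off-fibre j j≢σk with π j ≟ k
  ... | yes πj≡k = ⊥-elim (j≢σk (trans (sym (σπ j)) (cong σ πj≡k)))
  ... | no _     = ∧-zeroʳ (p j)
  at-σk : p (σ k) ∧ does (π (σ k) ≟ k) ≡ p (σ k)
  at-σk with π (σ k) ≟ k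
  ... | yes _   = ∧-identityʳ (p (σ k))
  ... | no πσ≢k = ⊥-elim (πσ≢k (πσ k))

infixl 6 _⊕_

_⊕_ : ∀ {s} → Vec Bool s → (Fin s → Bool) → Vec Bool s
x ⊕ v = tabulate (λ k → lookup x k xor v k)

module _ {s : ℕ} where

  lookup-⊕ : ∀ (x : Vec Bool s) v k → lookup (x ⊕ v) k ≡ lookup x k xor v k
  lookup-⊕ x v = lookup∘tabulate _

  ⊕-cong : ∀ (x : Vec Bool s) {u v} → (∀ k → u k ≡ v k) → x ⊕ u ≡ x ⊕ v
  ⊕-cong x u≗v = tabulate-cong (λ k → cong (lookup x k xor_) (u≗v k))

  ⊕-identityʳ : ∀ (x : Vec Bool s) → x ⊕ (λ _ → false) ≡ x
  ⊕-identityʳ x = trans (tabulate-cong (λ k → xor-identityʳ (lookup x k))) (tabulate∘lookup x)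

  ⊕-assoc : ∀ (x : Vec Bool s) u v → x ⊕ u ⊕ v ≡ x ⊕ (λ k → u k xor v k)
  ⊕-assoc x u v = tabulate-cong λ k →
    trans (cong (_xor v k) (lookup-⊕ x u k)) (xor-assoc (lookup x k) (u k) (v k))

  ⊕-involutive : ∀ (x : Vec Bool s) v → x ⊕ v ⊕ v ≡ x
  ⊕-involutive x v = trans (⊕-assoc x v v) (trans (⊕-cong x (λ k → xor-same (v k))) (⊕-identityʳ x))

  ⊕-cancelˡ : ∀ (x : Vec Bool s) {u v} → x ⊕ u ≡ x ⊕ v → ∀ k → u k ≡ v k
  ⊕-cancelˡ x {u} {v} eq k = ∙-cancelˡ (lookup x k) (u k) (v k)
    (trans (sym (lookup-⊕ x u k)) (trans (cong (λ y → lookup y k) eq) (lookup-⊕ x v k)))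

  updateAt-not : ∀ (x : Vec Bool s) j → updateAt x j not ≡ x ⊕ (λ k → does (j ≟ k))
  updateAt-not x j = trans (sym (tabulate∘lookup _)) (tabulate-cong flipped)
    where
    flipped : ∀ k → lookup (updateAt x j not) k ≡ lookup x k xor does (j ≟ k)
    flipped k with j ≟ k
    ... | yes refl = trans (lookup∘updateAt j x) (sym (trans (xor-comm _ true) (true-xor _)))
    ... | no j≢k   = trans (lookup∘updateAt′ k j (j≢k ∘ sym) x) (sym (xor-identityʳ _))

module Automorphisms {n m : ℕ} (M : Maniplex n m) where
  open Maniplex M

  inverse : ∀ {α} → IsAut α → Fin m → Fin m
  inverse ((α⁻¹ , _ , _) , _) = α⁻¹

  inverse∘aut : ∀ {α} (aut : IsAut α) Φ → inverse aut (α Φ) ≡ Φ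
  inverse∘aut ((_ , α⁻¹α , _) , _) = α⁻¹α

  aut∘inverse : ∀ {α} (aut : IsAut α) Φ → α (inverse aut Φ) ≡ Φ
  aut∘inverse ((_ , _ , αα⁻¹) , _) = αα⁻¹

  inverse-isAut : ∀ {α} (aut : IsAut α) → IsAut (inverse aut)
  inverse-isAut {α} ((α⁻¹ , α⁻¹α , αα⁻¹) , commutes) = (α , αα⁻¹ , α⁻¹α) , λ i Φ → begin
    α⁻¹ (r i Φ)             ≡⟨ cong (α⁻¹ ∘ r i) (sym (αα⁻¹ Φ)) ⟩
    α⁻¹ (r i (α (α⁻¹ Φ)))   ≡⟨ cong α⁻¹ (sym (commutes i (α⁻¹ Φ))) ⟩
    α⁻¹ (α (r i (α⁻¹ Φ)))   ≡⟨ α⁻¹α (r i (α⁻¹ Φ)) ⟩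
    r i (α⁻¹ Φ)             ∎
    where open ≡-Reasoning

  ∘-isAut : ∀ {α β} → IsAut α → IsAut β → IsAut (α ∘ β)
  ∘-isAut {α} {β} ((α⁻¹ , α⁻¹α , αα⁻¹) , α-commutes) ((β⁻¹ , β⁻¹β , ββ⁻¹) , β-commutes) =
    ( β⁻¹ ∘ α⁻¹
    , (λ Φ → trans (cong β⁻¹ (α⁻¹α (β Φ))) (β⁻¹β Φ))
    , (λ Φ → trans (cong α (ββ⁻¹ (α⁻¹ Φ))) (αα⁻¹ Φ)) )
    , λ i Φ → trans (cong α (β-commutes i Φ)) (α-commutes i (β Φ))

module FacetAction {n m s : ℕ} (M : Maniplex n m) (L : FacetLabelling M s) where
  open Maniplex M
  open FacetLabelling L
  open Automorphisms M

  representative : Fin s → Fin m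
  representative j = proj₁ (surj j)

  facetMap : (Fin m → Fin m) → Fin s → Fin s
  facetMap α j = facet (α (representative j))

  facet-equivariant : ∀ {α} → IsAut α → ∀ Φ → facet (α Φ) ≡ facetMap α (facet Φ)
  facet-equivariant {α} aut Φ =
    Equivalence.from (exact _ _) (sameOrbit-equivariant r r α (proj₂ aut)
      (Equivalence.to (exact _ _) (sym (proj₂ (surj (facet Φ))))))

  facetMap-inverse : ∀ {α} (aut : IsAut α) j → facetMap (inverse aut) (facetMap α j) ≡ j
  facetMap-inverse {α} aut j = begin
    facetMap (inverse aut) (facet (α (representative j)))  ≡⟨ facet-equivariant (inverse-isAut aut) _ ⟨
    facet (inverse aut (α (representative j)))             ≡⟨ cong facet (inverse∘aut aut _) ⟩
    facet (representative j)                               ≡⟨ proj₂ (surj j) ⟩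
    j                                                      ∎
    where open ≡-Reasoning

module TwoHat {n m s : ℕ} (M : Maniplex n m) (f : Fin m → Fin s) where
  open Maniplex M

  R : Fin (suc n) → Flag2 m s → Flag2 m s
  R = r′ M f

  r′-inject₁ : ∀ i Φ x → R (inject₁ i) (Φ , x) ≡ (r i Φ , x)
  r′-inject₁ i Φ x with toℕ (inject₁ i) <? n
  ... | yes i<n = cong (λ j → r j Φ , x) (toℕ-injective (trans (toℕ-fromℕ< i<n) (toℕ-inject₁ i)))
  ... | no  i≮n = ⊥-elim (i≮n (subst (_< n) (sym (toℕ-inject₁ i)) (toℕ<n i)))

  r′-fromℕ : ∀ Φ x → R (fromℕ n) (Φ , x) ≡ (Φ , x ⊕ (λ k → does (f Φ ≟ k)))
  r′-fromℕ Φ x with toℕ (fromℕ n) <? n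
  ... | yes n<n = ⊥-elim (<-irrefl (toℕ-fromℕ n) n<n)
  ... | no  _   = cong (Φ ,_) (updateAt-not x (f Φ))

  sameFacet2-snd : ∀ {a b} → SameFacet2 M f a b → proj₂ a ≡ proj₂ b
  sameFacet2-snd = sameOrbit-invariant R proj₂ r′-snd
    where
    r′-snd : ∀ i → toℕ i < n → ∀ a → proj₂ (R i a) ≡ proj₂ a
    r′-snd i i<n (Φ , x) with toℕ i <? n
    ... | yes _   = refl
    ... | no  i≮n = ⊥-elim (i≮n i<n)

  act-lift : ∀ w Φ x → act R (map inject₁ w) (Φ , x) ≡ (act r w Φ , x)
  act-lift w Φ x =
    trans (act-map R inject₁ w (Φ , x)) (sym (act-equivariant r (R ∘ inject₁) (_, x) (λ i Φ → sym (r′-inject₁ i Φ x)) w Φ))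

  Translates : List (Fin (suc n)) → (Fin m → Fin s → Bool) → Set
  Translates w v = ∀ Φ x → act R w (Φ , x) ≡ (Φ , x ⊕ v Φ)

  translates-cong : ∀ {w u v} → (∀ Φ k → u Φ k ≡ v Φ k) → Translates w u → Translates w v
  translates-cong u≗v w-u Φ x = trans (w-u Φ x) (cong (Φ ,_) (⊕-cong x (u≗v Φ)))

  translates-[] : Translates [] (λ _ _ → false)
  translates-[] Φ x = cong (Φ ,_) (sym (⊕-identityʳ x))

  translates-++ : ∀ {w w' u v} → Translates w u → Translates w' v →
                  Translates (w ++ w') (λ Φ k → u Φ k xor v Φ k)
  translates-++ {w} {w'} {u} {v} w-u w'-v Φ x = begin
    act R (w ++ w') (Φ , x)        ≡⟨ act-++ R w w' (Φ , x) ⟩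
    act R w' (act R w (Φ , x))     ≡⟨ cong (act R w') (w-u Φ x) ⟩
    act R w' (Φ , x ⊕ u Φ)         ≡⟨ w'-v Φ (x ⊕ u Φ) ⟩
    (Φ , x ⊕ u Φ ⊕ v Φ)            ≡⟨ cong (Φ ,_) (⊕-assoc x (u Φ) (v Φ)) ⟩
    (Φ , x ⊕ (λ k → u Φ k xor v Φ k)) ∎
    where open ≡-Reasoning

  translates-concat : ∀ {t} {w : Fin t → List (Fin (suc n))} {v : Fin t → Fin m → Fin s → Bool} →
    (∀ j → Translates (w j) (v j)) → Translates (concat (List.tabulate w)) (λ Φ k → sum (λ j → v j Φ k))
  translates-concat {0}     w-v = translates-[]
  translates-concat {suc t} {w} w-v =
    translates-++ {w = w zero} (w-v zero) (translates-concat {w = w ∘ suc} (w-v ∘ suc))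

  -- The conjugate u r′ₙ u⁻¹; the index inject₁ i stands for r′ᵢ and fromℕ n for r′ₙ.
  flipAlong : List (Fin n) → List (Fin (suc n))
  flipAlong u = map inject₁ u ++ fromℕ n ∷ map inject₁ (reverse u)

  flipAlong-translates : ∀ u → Translates (flipAlong u) (λ Φ k → does (f (act r u Φ) ≟ k))
  flipAlong-translates u Φ x = begin
    act R (flipAlong u) (Φ , x)                                ≡⟨ act-++ R (map inject₁ u) _ (Φ , x) ⟩
    act R (fromℕ n ∷ back) (act R (map inject₁ u) (Φ , x))     ≡⟨ cong (act R (fromℕ n ∷ back)) (act-lift u Φ x) ⟩
    act R back (R (fromℕ n) (act r u Φ , x))                   ≡⟨ cong (act R back) (r′-fromℕ (act r u Φ) x) ⟩
    act R back (act r u Φ , x′)                                ≡⟨ act-lift (reverse u) (act r u Φ) x′ ⟩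
    (act r (reverse u) (act r u Φ) , x′)                       ≡⟨ cong (_, x′) (act-reverse r involution u Φ) ⟩
    (Φ , x′)                                                   ∎
    where
    open ≡-Reasoning
    back = map inject₁ (reverse u)
    x′ = x ⊕ (λ k → does (f (act r u Φ) ≟ k))

Rigid : ∀ {n m s} (M : Maniplex n m) (L : FacetLabelling M s) → (Fin s → Bool) → Set
Rigid {m = m} M L S₀ = ∀ (α : Fin m → Fin m) → Maniplex.IsAut M α →
  (∀ Φ → S₀ (FacetLabelling.facet L (α Φ)) ≡ S₀ (FacetLabelling.facet L Φ)) → ∀ Φ → α Φ ≡ Φ

rigid-complement : ∀ {n m s} {M : Maniplex n m} {L : FacetLabelling M s} {S₀ : Fin s → Bool} →
  Rigid M L S₀ → Rigid M L (not ∘ S₀)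
rigid-complement rigid α aut preserves = rigid α aut (not-injective ∘ preserves)

FacetSeparating : ∀ {n m s} (M : Maniplex n m) (f : Fin m → Fin s) → (Flag2 m s → Flag2 m s) → Set
FacetSeparating M f η = ∀ a b → a ≢ b → SameFacet2 M f a b → ¬ SameFacet2 M f (η a) (η b)

module Construction {n m s : ℕ} (M : Maniplex n m) (L : FacetLabelling M s)
  (regular : Maniplex.IsRegular M) (S₀ : Fin s → Bool) (rigid : Rigid M L S₀) where
  open Maniplex M
  open FacetLabelling L
  open Automorphisms M
  open FacetAction M L
  open TwoHat M facet

  base : Fin m
  base = fromℕ< nonempty

  transport : Fin m → Fin m → Fin m
  transport Φ = proj₁ (regular base Φ)

  transport-isAut : ∀ Φ → IsAut (transport Φ)
  transport-isAut Φ = proj₁ (proj₂ (regular base Φ))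

  transport-base : ∀ Φ → transport Φ base ≡ Φ
  transport-base Φ = proj₂ (proj₂ (regular base Φ))

  path : Fin s → List (Fin n)
  path j = proj₁ (transitive base (representative j))

  act-path : ∀ j Φ → act r (path j) Φ ≡ transport Φ (representative j)
  act-path j Φ = begin
    act r (path j) Φ                   ≡⟨ cong (act r (path j)) (transport-base Φ) ⟨
    act r (path j) (transport Φ base)  ≡⟨ act-equivariant r r (transport Φ) (proj₂ (transport-isAut Φ)) (path j) base ⟨
    transport Φ (act r (path j) base)  ≡⟨ cong (transport Φ) (proj₂ (transitive base (representative j))) ⟩
    transport Φ (representative j)     ∎
    where open ≡-Reasoning

  mask : Fin m → Fin s → Bool
  mask Φ k = S₀ (facetMap (inverse (transport-isAut Φ)) k)

  ηWord : List (Fin (suc n))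
  ηWord = concat (List.tabulate (λ j → if S₀ j then flipAlong (path j) else []))

  ηWord-translates : Translates ηWord mask
  ηWord-translates = translates-cong {w = ηWord} sum≡mask (translates-concat flipIfS₀)
    where
    flipIfS₀ : ∀ j → Translates (if S₀ j then flipAlong (path j) else [])
                                (λ Φ k → S₀ j ∧ does (facetMap (transport Φ) j ≟ k))
    flipIfS₀ j with S₀ j
    ... | true  = translates-cong {w = flipAlong (path j)}
                    (λ Φ k → cong (λ F → does (facet F ≟ k)) (act-path j Φ)) (flipAlong-translates (path j))
    ... | false = translates-[]
    sum≡mask : ∀ Φ k → sum (λ j → S₀ j ∧ does (facetMap (transport Φ) j ≟ k)) ≡ mask Φ k
    sum≡mask Φ = sum-∧-fibre S₀ _ _ (facetMap-inverse (transport-isAut Φ))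
                                 (facetMap-inverse (inverse-isAut (transport-isAut Φ)))

  mask-transport : ∀ Φ j → mask Φ (facetMap (transport Φ) j) ≡ S₀ j
  mask-transport Φ j = cong S₀ (facetMap-inverse (transport-isAut Φ) j)

  mask-injective : ∀ Φ Φ′ → (∀ k → mask Φ k ≡ mask Φ′ k) → Φ ≡ Φ′
  mask-injective Φ Φ′ same = begin
    Φ                                   ≡⟨ aut∘inverse aut′ Φ ⟨
    transport Φ′ (inverse aut′ Φ)       ≡⟨ cong (transport Φ′ ∘ inverse aut′) (transport-base Φ) ⟨
    transport Φ′ (α base)               ≡⟨ cong (transport Φ′) (rigid α (∘-isAut (inverse-isAut aut′) aut) α-preserves base) ⟩
    transport Φ′ base                   ≡⟨ transport-base Φ′ ⟩
    Φ′                                  ∎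
    where
    open ≡-Reasoning
    aut = transport-isAut Φ
    aut′ = transport-isAut Φ′
    α : Fin m → Fin m
    α = inverse aut′ ∘ transport Φ
    α-preserves : ∀ Z → S₀ (facet (α Z)) ≡ S₀ (facet Z)
    α-preserves Z = begin
      S₀ (facet (α Z))                                         ≡⟨ cong S₀ (facet-equivariant (inverse-isAut aut′) _) ⟩
      mask Φ′ (facet (transport Φ Z))                          ≡⟨ same _ ⟨
      mask Φ (facet (transport Φ Z))                           ≡⟨ cong S₀ (facet-equivariant (inverse-isAut aut) _) ⟨
      S₀ (facet (inverse aut (transport Φ Z)))                 ≡⟨ cong (S₀ ∘ facet) (inverse∘aut aut Z) ⟩
      S₀ (facet Z)                                             ∎

  η : Flag2 m s → Flag2 m s
  η = act R ηWord

  η-involutive : ∀ a → η (η a) ≡ a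
  η-involutive (Φ , x) = begin
    η (η (Φ , x))                ≡⟨ cong η (ηWord-translates Φ x) ⟩
    η (Φ , x ⊕ mask Φ)           ≡⟨ ηWord-translates Φ (x ⊕ mask Φ) ⟩
    (Φ , x ⊕ mask Φ ⊕ mask Φ)    ≡⟨ cong (Φ ,_) (⊕-involutive x (mask Φ)) ⟩
    (Φ , x)                      ∎
    where open ≡-Reasoning

  η-nontrivial : ∀ {j} → S₀ j ≡ true → ∀ Φ x → η (Φ , x) ≢ (Φ , x)
  η-nontrivial {j} S₀j Φ x fixed = true≢false (begin
    true                                ≡⟨ S₀j ⟨
    S₀ j                                ≡⟨ mask-transport Φ j ⟨
    mask Φ (facetMap (transport Φ) j)   ≡⟨ ⊕-cancelˡ x mask-vanishes _ ⟩
    false                               ∎)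
    where
    open ≡-Reasoning
    true≢false : true ≢ false
    true≢false ()
    mask-vanishes : x ⊕ mask Φ ≡ x ⊕ (λ _ → false)
    mask-vanishes = trans (cong proj₂ (trans (sym (ηWord-translates Φ x)) fixed)) (sym (⊕-identityʳ x))

  η-separates : FacetSeparating M facet η
  η-separates (Φ , x) (Φ′ , y) a≢b same with sameFacet2-snd same
  ... | refl = λ same′ → a≢b (cong (_, x) (mask-injective Φ Φ′ (⊕-cancelˡ x (masks-agree same′))))
    where
    masks-agree : SameFacet2 M facet (η (Φ , x)) (η (Φ′ , x)) → x ⊕ mask Φ ≡ x ⊕ mask Φ′
    masks-agree same′ = trans (cong proj₂ (sym (ηWord-translates Φ x)))
                          (trans (sameFacet2-snd same′) (cong proj₂ (ηWord-translates Φ′ x)))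

  facetSeparatingInvolution : ∀ {j} → S₀ j ≡ true →
    Σ (Flag2 m s → Flag2 m s) λ η →
      InMon R η × (∀ a → η (η a) ≡ a) × (∃ λ a → η a ≢ a) × FacetSeparating M facet η
  facetSeparatingInvolution S₀j =
    η , (ηWord , λ _ → refl) , η-involutive , ((base , replicate s false) , η-nontrivial S₀j base _) , η-separates

lemma12 : {n m s : ℕ} (M : Maniplex n m) (L : FacetLabelling M s) →
    Maniplex.IsRegular M →
    (S₀ : Fin s → Bool) →
    (∀ α → Maniplex.IsAut M α →
       (∀ Φ → S₀ (FacetLabelling.facet L (α Φ)) ≡ S₀ (FacetLabelling.facet L Φ)) →
       ∀ Φ → α Φ ≡ Φ) →
    Σ (Flag2 m s → Flag2 m s) λ η →
      InMon (r′ M (FacetLabelling.facet L)) η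
      × (∀ a → η (η a) ≡ a)
      × (∃ λ a → η a ≢ a)
      × (∀ a b → a ≢ b →
           SameFacet2 M (FacetLabelling.facet L) a b →
           ¬ SameFacet2 M (FacetLabelling.facet L) (η a) (η b))
lemma12 M L regular S₀ rigid with S₀ (FacetLabelling.facet L (fromℕ< (Maniplex.nonempty M))) in S₀j
... | true  = Construction.facetSeparatingInvolution M L regular S₀ rigid S₀j
... | false = Construction.facetSeparatingInvolution M L regular (not ∘ S₀) (rigid-complement {M = M} {L} {S₀} rigid) (cong not S₀j)
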